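{- For every integer $n\geq 0$, the number of Fishburn permutations of length $n$ that simultaneously avoid the classical patterns $321$, $2143$ and $3124$ equals $\binom{n}{2}+1$.
   Context: A permutation of length $n$ is a rearrangement $\pi=\pi_1\cdots\pi_n$ of $[n]$ (for $n=0$ there is exactly one, the empty permutation). A permutation $\pi$ contains a classical pattern $p\in S_k$ if some subsequence of $\pi$ of length $k$ is order-isomorphic to $p$; otherwise it avoids $p$. A Fishburn permutation is a permutation $\pi$ for which there are no indices $i<j$ with $\pi_j<\pi_i<\pi_{i+1}$ and $\pi_i=\pi_j+1$. -}

module Defs where

open import Data.Nat using (ℕ; _<_)
open import Data.Fin using (Fin; toℕ; _<_; suc)
open import Data.Vec using (Vec; lookup)
open import Data.Product using (_×_; ∃-syntax; Σ-syntax)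
open import Relation.Binary.PropositionalEquality using (_≡_)
open import Relation.Nullary using (¬_)
open import Function.Definitions using (Injective)

-- A permutation of length n (one-line notation π₁⋯πₙ) is a vector of n
-- entries in Fin n (values 0..n-1 standing for 1..n) that is injective,
-- hence a rearrangement of [n].
IsPerm : ∀ {n} → Vec (Fin n) n → Set
IsPerm {n} π = Injective _≡_ _≡_ (lookup π)

Occurs : ∀ {k n} → Vec (Fin k) k → Vec (Fin n) n → Set
Occurs {k} {n} p π =
  Σ[ ι ∈ (Fin k → Fin n) ] ((∀ (a b : Fin k) → a Data.Fin.< b → ι a Data.Fin.< ι b)
         × (∀ (a b : Fin k) → lookup p a Data.Fin.< lookup p b
                           → lookup π (ι a) Data.Fin.< lookup π (ι b))
         × (∀ (a b : Fin k) → lookup π (ι a) Data.Fin.< lookup π (ι b)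
                           → lookup p a Data.Fin.< lookup p b))

Contains : ∀ {k n} → Vec (Fin k) k → Vec (Fin n) n → Set
Contains = Occurs

Avoids : ∀ {k n} → Vec (Fin k) k → Vec (Fin n) n → Set
Avoids p π = ¬ Contains p π

-- Fishburn: no indices i < j with π_j < π_i < π_{i+1} and π_i = π_j + 1.
-- Positions are 0-based; the position i+1 is a second index i+1 : Fin n
-- constrained by toℕ i+1 ≡ suc (toℕ i) (so i+1 must exist, i.e. i < n-1).
Fishburn : ∀ {n} → Vec (Fin n) n → Set
Fishburn {n} π =
  ¬ (∃[ i ] ∃[ i+1 ] ∃[ j ]
       (toℕ i+1 ≡ Data.Nat.suc (toℕ i))
     × (i Data.Fin.< j)
     × (lookup π j Data.Fin.< lookup π i)
     × (lookup π i Data.Fin.< lookup π i+1)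
     × (toℕ (lookup π i) ≡ Data.Nat.suc (toℕ (lookup π j))))

open import Data.Vec using ([]; _∷_)
open import Data.Fin using (zero)

p321 : Vec (Fin 3) 3
p321 = suc (suc zero) ∷ suc zero ∷ zero ∷ []

p2143 : Vec (Fin 4) 4
p2143 = suc zero ∷ zero ∷ suc (suc (suc zero)) ∷ suc (suc zero) ∷ []

p3124 : Vec (Fin 4) 4
p3124 = suc (suc zero) ∷ zero ∷ suc zero ∷ suc (suc (suc zero)) ∷ []

Counted : ∀ {n} → Vec (Fin n) n → Set
Counted π = IsPerm π × Fishburn π × Avoids p321 π × Avoids p2143 π × Avoids p3124 π

{-# OPTIONS --safe #-}
module Submission where

-- A counted permutation of length n + 1 either starts with 0, and is then 1 ⊕ σ for a counted σ
-- of length n (1 ⊕ − preserves the Fishburn property, and none of 321, 2143, 3124 starts with its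
-- minimum), or starts with some J ≥ 1.  In the second case the Fishburn condition puts the second
-- entry below J, avoiding 321 makes it 0, and avoiding 321, 2143 and 3124 forces the remaining
-- entries to be J+1, …, n, 1, …, J−1 in this order; conversely this permutation is counted.  Hence
-- the counts satisfy c(n+1) = c(n) + n, so c(n) = C(n,2) + 1.

open import Defs
open import Data.Nat using (ℕ; zero; suc; _+_; _∸_; _≤_; _<_; _≤?_; z<s; s<s; s<s⁻¹)
import Data.Nat.Properties as ℕ
open import Data.Nat.Combinatorics using (_C_; nC1≡n; nCk+nC[k+1]≡[n+1]C[k+1])
open import Data.Fin using (Fin; zero; suc; toℕ; fromℕ<; inject₁; punchOut)
import Data.Fin as F
import Data.Fin.Properties as FinP
open import Data.Fin.Induction using (<-wellFounded)
open import Data.Vec using (Vec; []; _∷_; lookup; tabulate)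
import Data.Vec as Vec
open import Data.Vec.Properties using (lookup-map; lookup∘tabulate)
open import Data.Vec.Relation.Binary.Pointwise.Extensional using (ext; Pointwise-≡⇒≡)
open import Data.List using (List; length; _++_; allFin; [_])
import Data.List as List
open import Data.List.Properties using (length-++; length-map; length-tabulate)
open import Data.List.Membership.Propositional using (_∈_)
open import Data.List.Membership.Propositional.Properties
  using (∈-map⁺; ∈-map⁻; ∈-++⁺ˡ; ∈-++⁺ʳ; ∈-++⁻; ∈-allFin)
open import Data.List.Relation.Unary.All using ([])
open import Data.List.Relation.Unary.AllPairs using ([]; _∷_)
open import Data.List.Relation.Unary.Any using (here)
open import Data.List.Relation.Unary.Unique.Propositional using (Unique)
open import Data.List.Relation.Unary.Unique.Propositional.Properties using (++⁺; map⁺; allFin⁺)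
open import Data.Product using (_×_; _,_; proj₁; proj₂; ∃₂; ∃-syntax)
open import Data.Sum using (_⊎_; inj₁; inj₂)
open import Data.Empty using (⊥-elim)
open import Function using (_∘_; _$_)
open import Function.Bundles using (_⇔_; mk⇔; Equivalence)
open import Induction.WellFounded using (Acc; acc)
open import Relation.Binary using (Rel; Asymmetric; Transitive; DecidableEquality; tri<; tri≈; tri>)
open import Relation.Binary.PropositionalEquality
  using (_≡_; _≢_; refl; sym; trans; cong; cong₂; subst; subst₂; module ≡-Reasoning)
open import Relation.Nullary using (¬_; yes; no)

infix 10 _!_

_!_ : ∀ {n} → Vec (Fin n) n → Fin n → ℕ
π ! x = toℕ (lookup π x)

injective⇒onto : ∀ {n} (f : Fin n → Fin n) → (∀ {x y} → f x ≡ f y → x ≡ y) →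
                 ∀ v → ∃[ i ] f i ≡ v
injective⇒onto {zero} f inj ()
injective⇒onto {suc n} f inj v with FinP.any? (λ i → f i FinP.≟ v)
... | yes hit = hit
... | no miss = ⊥-elim (no-collision (FinP.pigeonhole (ℕ.n<1+n n) (λ i → punchOut (misses i))))
  where
  misses : ∀ i → v ≢ f i
  misses i e = miss (i , sym e)
  no-collision : ¬ ∃₂ λ i j → i F.< j × punchOut (misses i) ≡ punchOut (misses j)
  no-collision (i , j , i<j , eq) =
    ℕ.<-irrefl (cong toℕ (inj (FinP.punchOut-injective (misses i) (misses j) eq))) i<j

module _ {a ℓ} {A : Set a} {_≺_ : Rel A ℓ} (≺-trans : Transitive _≺_) where

  chain⇒increasing : ∀ {k} (f : Fin (suc k) → A) → (∀ a → f (inject₁ a) ≺ f (suc a)) →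
                     ∀ {a b} → a F.< b → f a ≺ f b
  chain⇒increasing {suc k} f step {zero} {suc zero} _ = step zero
  chain⇒increasing {suc k} f step {zero} {suc (suc b)} _ =
    ≺-trans (step zero) (chain⇒increasing (f ∘ suc) (step ∘ suc) {zero} {suc b} z<s)
  chain⇒increasing {suc k} f step {suc a} {suc b} (s<s a<b) =
    chain⇒increasing (f ∘ suc) (step ∘ suc) a<b

-- ι lists the positions of the occurrence; read through p⁻¹ it lists them by increasing pattern value.
occurs-of-chains : ∀ {k n} (p p⁻¹ : Vec (Fin (suc k)) (suc k)) → (∀ a → lookup p⁻¹ (lookup p a) ≡ a) →
                   (π : Vec (Fin n) n) (ι : Vec (Fin n) (suc k)) →
                   (∀ a → lookup ι (inject₁ a) F.< lookup ι (suc a)) →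
                   (∀ a → π ! lookup ι (lookup p⁻¹ (inject₁ a)) < π ! lookup ι (lookup p⁻¹ (suc a))) →
                   Occurs p π
occurs-of-chains p p⁻¹ p⁻¹∘p≡id π ι positions values = lookup ι , increasing , preserves , reflects
  where
  increasing : ∀ a b → a F.< b → lookup ι a F.< lookup ι b
  increasing _ _ = chain⇒increasing {_≺_ = _<_} ℕ.<-trans (toℕ ∘ lookup ι) positions
  preserves : ∀ a b → lookup p a F.< lookup p b → π ! lookup ι a < π ! lookup ι b
  preserves a b pa<pb =
    subst₂ (λ a′ b′ → π ! lookup ι a′ < π ! lookup ι b′) (p⁻¹∘p≡id a) (p⁻¹∘p≡id b)
    (chain⇒increasing {_≺_ = _<_} ℕ.<-trans (λ c → π ! lookup ι (lookup p⁻¹ c)) values pa<pb)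
  p-injective : ∀ {a b} → lookup p a ≡ lookup p b → a ≡ b
  p-injective {a} {b} e = trans (sym (p⁻¹∘p≡id a)) (trans (cong (lookup p⁻¹) e) (p⁻¹∘p≡id b))
  reflects : ∀ a b → π ! lookup ι a < π ! lookup ι b → lookup p a F.< lookup p b
  reflects a b lt with FinP.<-cmp (lookup p a) (lookup p b)
  ... | tri< pa<pb _ _ = pa<pb
  ... | tri≈ _ pa≡pb _ = ⊥-elim (ℕ.<-irrefl (cong (λ c → π ! lookup ι c) (p-injective pa≡pb)) lt)
  ... | tri> _ _ pb<pa = ⊥-elim (ℕ.<-asym lt (preserves b a pb<pa))

Occurs321 : ∀ {n} → Vec (Fin n) n → Set
Occurs321 π = ∃[ a ] ∃[ b ] ∃[ c ] a F.< b × b F.< c × π ! c < π ! b × π ! b < π ! a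

Occurs2143 : ∀ {n} → Vec (Fin n) n → Set
Occurs2143 π = ∃[ a ] ∃[ b ] ∃[ c ] ∃[ d ] a F.< b × b F.< c × c F.< d ×
               π ! b < π ! a × π ! a < π ! d × π ! d < π ! c

Occurs3124 : ∀ {n} → Vec (Fin n) n → Set
Occurs3124 π = ∃[ a ] ∃[ b ] ∃[ c ] ∃[ d ] a F.< b × b F.< c × c F.< d ×
               π ! b < π ! c × π ! c < π ! a × π ! a < π ! d

module _ {n} {π : Vec (Fin n) n} where

  occurs-321 : Occurs p321 π ⇔ Occurs321 π
  occurs-321 = mk⇔
    (λ (ι , mono , fwd , _) → ι zero , ι (suc zero) , ι (suc (suc zero)) ,
       mono zero (suc zero) z<s , mono (suc zero) (suc (suc zero)) (s<s z<s) ,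
       fwd (suc (suc zero)) (suc zero) z<s , fwd (suc zero) zero (s<s z<s))
    (λ (a , b , c , a<b , b<c , c<b , b<a) → occurs-of-chains p321 p321
       (λ { zero → refl ; (suc zero) → refl ; (suc (suc zero)) → refl })
       π (a ∷ b ∷ c ∷ []) (λ { zero → a<b ; (suc zero) → b<c })
       (λ { zero → c<b ; (suc zero) → b<a }))

  occurs-2143 : Occurs p2143 π ⇔ Occurs2143 π
  occurs-2143 = mk⇔
    (λ (ι , mono , fwd , _) → ι zero , ι (suc zero) , ι (suc (suc zero)) , ι (suc (suc (suc zero))) ,
       mono zero (suc zero) z<s , mono (suc zero) (suc (suc zero)) (s<s z<s) ,
       mono (suc (suc zero)) (suc (suc (suc zero))) (s<s (s<s z<s)) ,
       fwd (suc zero) zero z<s , fwd zero (suc (suc (suc zero))) (s<s z<s) ,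
       fwd (suc (suc (suc zero))) (suc (suc zero)) (s<s (s<s z<s)))
    (λ (a , b , c , d , a<b , b<c , c<d , b<a , a<d , d<c) → occurs-of-chains p2143 p2143
       (λ { zero → refl ; (suc zero) → refl ; (suc (suc zero)) → refl ; (suc (suc (suc zero))) → refl })
       π (a ∷ b ∷ c ∷ d ∷ []) (λ { zero → a<b ; (suc zero) → b<c ; (suc (suc zero)) → c<d })
       (λ { zero → b<a ; (suc zero) → a<d ; (suc (suc zero)) → d<c }))

  occurs-3124 : Occurs p3124 π ⇔ Occurs3124 π
  occurs-3124 = mk⇔
    (λ (ι , mono , fwd , _) → ι zero , ι (suc zero) , ι (suc (suc zero)) , ι (suc (suc (suc zero))) ,
       mono zero (suc zero) z<s , mono (suc zero) (suc (suc zero)) (s<s z<s) ,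
       mono (suc (suc zero)) (suc (suc (suc zero))) (s<s (s<s z<s)) ,
       fwd (suc zero) (suc (suc zero)) z<s , fwd (suc (suc zero)) zero (s<s z<s) ,
       fwd zero (suc (suc (suc zero))) (s<s (s<s z<s)))
    (λ (a , b , c , d , a<b , b<c , c<d , b<c′ , c<a , a<d) → occurs-of-chains p3124 p3124⁻¹
       (λ { zero → refl ; (suc zero) → refl ; (suc (suc zero)) → refl ; (suc (suc (suc zero))) → refl })
       π (a ∷ b ∷ c ∷ d ∷ []) (λ { zero → a<b ; (suc zero) → b<c ; (suc (suc zero)) → c<d })
       (λ { zero → b<c′ ; (suc zero) → c<a ; (suc (suc zero)) → a<d }))
    where
    p3124⁻¹ : Vec (Fin 4) 4
    p3124⁻¹ = suc zero ∷ suc (suc zero) ∷ zero ∷ suc (suc (suc zero)) ∷ []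

OccursAt : ∀ {k n} → Vec (Fin k) k → Vec (Fin n) n → (Fin k → Fin n) → Set
OccursAt p π ι = (∀ a b → a F.< b → ι a F.< ι b)
               × (∀ a b → lookup p a F.< lookup p b → lookup π (ι a) F.< lookup π (ι b))
               × (∀ a b → lookup π (ι a) F.< lookup π (ι b) → lookup p a F.< lookup p b)

occursAt-cong : ∀ {k n} {p : Vec (Fin k) k} {π : Vec (Fin n) n} {ι ι′ : Fin k → Fin n} →
                (∀ a → ι a ≡ ι′ a) → OccursAt p π ι → OccursAt p π ι′
occursAt-cong {π = π} ι≗ι′ (mono , fwd , bwd) =
  (λ a b lt → subst₂ F._<_ (ι≗ι′ a) (ι≗ι′ b) (mono a b lt)) ,
  (λ a b lt → subst₂ π< (ι≗ι′ a) (ι≗ι′ b) (fwd a b lt)) ,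
  (λ a b lt → bwd a b (subst₂ π< (sym (ι≗ι′ a)) (sym (ι≗ι′ b)) lt))
  where
  π< : _ → _ → Set
  π< x y = π ! x < π ! y

1⊕_ : ∀ {n} → Vec (Fin n) n → Vec (Fin (suc n)) (suc n)
1⊕ σ = zero ∷ Vec.map suc σ

module _ {n} (σ : Vec (Fin n) n) where

  lookup-1⊕ : ∀ i → lookup (1⊕ σ) (suc i) ≡ suc (lookup σ i)
  lookup-1⊕ i = lookup-map i suc σ

  !-1⊕ : ∀ i → (1⊕ σ) ! suc i ≡ suc (σ ! i)
  !-1⊕ i = cong toℕ (lookup-1⊕ i)

  <-1⊕⁺ : ∀ {i j} → σ ! i < σ ! j → (1⊕ σ) ! suc i < (1⊕ σ) ! suc j
  <-1⊕⁺ {i} {j} lt = subst₂ _<_ (sym (!-1⊕ i)) (sym (!-1⊕ j)) (s<s lt)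

  <-1⊕⁻ : ∀ {i j} → (1⊕ σ) ! suc i < (1⊕ σ) ! suc j → σ ! i < σ ! j
  <-1⊕⁻ {i} {j} lt = s<s⁻¹ (subst₂ _<_ (!-1⊕ i) (!-1⊕ j) lt)

  isPerm-1⊕ : IsPerm σ ⇔ IsPerm (1⊕ σ)
  isPerm-1⊕ = mk⇔ to from
    where
    to : IsPerm σ → IsPerm (1⊕ σ)
    to inj {zero} {zero} _ = refl
    to inj {zero} {suc y} e with () ← trans e (lookup-1⊕ y)
    to inj {suc x} {zero} e with () ← trans (sym (lookup-1⊕ x)) e
    to inj {suc x} {suc y} e =
      cong suc (inj (FinP.suc-injective (trans (sym (lookup-1⊕ x)) (trans e (lookup-1⊕ y)))))
    from : IsPerm (1⊕ σ) → IsPerm σ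
    from inj {x} {y} e =
      FinP.suc-injective (inj (trans (lookup-1⊕ x) (trans (cong suc e) (sym (lookup-1⊕ y)))))

  fishburn-1⊕ : Fishburn σ ⇔ Fishburn (1⊕ σ)
  fishburn-1⊕ = mk⇔ to from
    where
    to : Fishburn σ → Fishburn (1⊕ σ)
    to fish (zero , _ , _ , _ , _ , _ , _ , ())
    to fish (suc i , zero , _ , () , _)
    to fish (suc i , suc i+1 , zero , _ , () , _)
    to fish (suc i , suc i+1 , suc j , e , s<s i<j , vj<vi , vi<vi+1 , vi≡1+vj) =
      fish (i , i+1 , j , ℕ.suc-injective e , i<j , <-1⊕⁻ vj<vi , <-1⊕⁻ vi<vi+1 ,
            ℕ.suc-injective (trans (sym (!-1⊕ i)) (trans vi≡1+vj (cong suc (!-1⊕ j)))))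
    from : Fishburn (1⊕ σ) → Fishburn σ
    from fish (i , i+1 , j , e , i<j , vj<vi , vi<vi+1 , vi≡1+vj) =
      fish (suc i , suc i+1 , suc j , cong suc e , s<s i<j , <-1⊕⁺ vj<vi , <-1⊕⁺ vi<vi+1 ,
            trans (!-1⊕ i) (cong suc (trans vi≡1+vj (sym (!-1⊕ j)))))

  occursAt-1⊕ : ∀ {k} (p : Vec (Fin k) k) {ι : Fin k → Fin n} →
                OccursAt p σ ι ⇔ OccursAt p (1⊕ σ) (suc ∘ ι)
  occursAt-1⊕ _ = mk⇔
    (λ (mono , fwd , bwd) → (λ a b lt → s<s (mono a b lt)) ,
                            (λ a b lt → <-1⊕⁺ (fwd a b lt)) , (λ a b lt → bwd a b (<-1⊕⁻ lt)))
    (λ (mono , fwd , bwd) → (λ a b lt → s<s⁻¹ (mono a b lt)) ,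
                            (λ a b lt → <-1⊕⁻ (fwd a b lt)) , (λ a b lt → bwd a b (<-1⊕⁺ lt)))

  -- The leading 0 could only be the first letter of an occurrence, and p₀ is not the minimum of p.
  avoids-1⊕ : ∀ {k} (p : Vec (Fin (suc (suc k))) (suc (suc k))) → lookup p (suc zero) F.< lookup p zero →
              Avoids p σ ⇔ Avoids p (1⊕ σ)
  avoids-1⊕ {k} p p₁<p₀ = mk⇔ (λ av → av ∘ drop-head) (λ av (ι , at) → av (suc ∘ ι , to (occursAt-1⊕ p) at))
    where
    open Equivalence
    drop-head : Occurs p (1⊕ σ) → Occurs p σ
    drop-head (ι , at@(mono , fwd , _)) =
      ι′ , from (occursAt-1⊕ p) (occursAt-cong {p = p} {π = 1⊕ σ} (sym ∘ suc∘ι′≗ι) at)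
      where
      misses-head : ∀ a → zero ≢ ι a
      misses-head zero e =
        ℕ.n≮0 (subst (λ x → (1⊕ σ) ! ι (suc zero) < (1⊕ σ) ! x) (sym e) (fwd (suc zero) zero p₁<p₀))
      misses-head (suc a) e = ℕ.n≮0 (subst (λ x → toℕ (ι zero) < toℕ x) (sym e) (mono zero (suc a) z<s))
      ι′ : Fin (suc (suc k)) → Fin n
      ι′ a = punchOut (misses-head a)
      suc∘ι′≗ι : ∀ a → suc (ι′ a) ≡ ι a
      suc∘ι′≗ι a = FinP.punchIn-punchOut (misses-head a)

  counted-1⊕ : Counted σ ⇔ Counted (1⊕ σ)
  counted-1⊕ = mk⇔
    (λ (perm , fish , a321 , a2143 , a3124) → to isPerm-1⊕ perm , to fishburn-1⊕ fish ,
       to (avoids-1⊕ p321 (s<s z<s)) a321 , to (avoids-1⊕ p2143 z<s) a2143 ,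
       to (avoids-1⊕ p3124 z<s) a3124)
    (λ (perm , fish , a321 , a2143 , a3124) → from isPerm-1⊕ perm , from fishburn-1⊕ fish ,
       from (avoids-1⊕ p321 (s<s z<s)) a321 , from (avoids-1⊕ p2143 z<s) a2143 ,
       from (avoids-1⊕ p3124 z<s) a3124)
    where open Equivalence

nonzero⇒map-suc : ∀ {n k} (τ : Vec (Fin (suc n)) k) → (∀ i → lookup τ i ≢ zero) →
                  ∃[ σ ] τ ≡ Vec.map suc σ
nonzero⇒map-suc [] _ = [] , refl
nonzero⇒map-suc (zero ∷ τ) nonzero = ⊥-elim (nonzero zero refl)
nonzero⇒map-suc (suc x ∷ τ) nonzero with σ , τ≡ ← nonzero⇒map-suc τ (nonzero ∘ suc) =
  x ∷ σ , cong (suc x ∷_) τ≡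

starts-with-0⇒1⊕ : ∀ {n} (π : Vec (Fin (suc n)) (suc n)) → IsPerm π → lookup π zero ≡ zero →
                   ∃[ σ ] π ≡ 1⊕ σ
starts-with-0⇒1⊕ (zero ∷ τ) perm refl
  with σ , τ≡ ← nonzero⇒map-suc τ (λ i e → FinP.0≢1+n (sym (perm {suc i} {zero} e))) =
  σ , cong (zero ∷_) τ≡

-- The order J+1, J+2, …, 0, 1, …, J−1 on ℕ ∖ {J}.
infix 4 _<[_]_

data _<[_]_ (v J w : ℕ) : Set where
  above  : J < v → v < w → v <[ J ] w
  across : J < v → w < J → v <[ J ] w
  below  : w < J → v < w → v <[ J ] w

module _ {v J w : ℕ} where

  <[]-above : v <[ J ] w → J < w → J < v × v < w
  <[]-above (above J<v v<w) _ = J<v , v<w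
  <[]-above (across _ w<J) J<w = ⊥-elim (ℕ.<-asym w<J J<w)
  <[]-above (below w<J _) J<w = ⊥-elim (ℕ.<-asym w<J J<w)

  <[]-descent : v <[ J ] w → w < v → J < v × w < J
  <[]-descent (above _ v<w) w<v = ⊥-elim (ℕ.<-asym v<w w<v)
  <[]-descent (across J<v w<J) _ = J<v , w<J
  <[]-descent (below _ v<w) w<v = ⊥-elim (ℕ.<-asym v<w w<v)

<[]-irrefl : ∀ {v J} → ¬ v <[ J ] v
<[]-irrefl (above _ v<v) = ℕ.<-irrefl refl v<v
<[]-irrefl (across J<v v<J) = ℕ.<-asym J<v v<J
<[]-irrefl (below _ v<v) = ℕ.<-irrefl refl v<v

<[]-asym : ∀ {J} → Asymmetric (_<[ J ]_)
<[]-asym {J} {v} {w} v◁w w◁v with ℕ.<-cmp v w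
... | tri< v<w _ _ = let J<w , v<J = <[]-descent w◁v v<w in ℕ.<-asym (proj₁ (<[]-above v◁w J<w)) v<J
... | tri≈ _ refl _ = <[]-irrefl v◁w
... | tri> _ _ w<v = let J<v , w<J = <[]-descent v◁w w<v in ℕ.<-asym (proj₁ (<[]-above w◁v J<v)) w<J

<[]-total : ∀ {v J w} → v ≢ J → w ≢ J → v ≢ w → v <[ J ] w ⊎ w <[ J ] v
<[]-total {v} {J} {w} v≢J w≢J v≢w with ℕ.<-cmp J v | ℕ.<-cmp J w | ℕ.<-cmp v w
... | tri≈ _ J≡v _ | _ | _ = ⊥-elim (v≢J (sym J≡v))
... | _ | tri≈ _ J≡w _ | _ = ⊥-elim (w≢J (sym J≡w))
... | _ | _ | tri≈ _ v≡w _ = ⊥-elim (v≢w v≡w)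
... | tri< J<v _ _ | tri< _ _ _ | tri< v<w _ _ = inj₁ (above J<v v<w)
... | tri< _ _ _ | tri< J<w _ _ | tri> _ _ w<v = inj₂ (above J<w w<v)
... | tri< J<v _ _ | tri> _ _ w<J | _ = inj₁ (across J<v w<J)
... | tri> _ _ v<J | tri< J<w _ _ | _ = inj₂ (across J<w v<J)
... | tri> _ _ _ | tri> _ _ w<J | tri< v<w _ _ = inj₁ (below w<J v<w)
... | tri> _ _ v<J | tri> _ _ _ | tri> _ _ w<v = inj₂ (below v<J w<v)

module _ {a ℓ} {A : Set a} {_≺_ : Rel A ℓ} (≺-asym : Asymmetric _≺_) where

  private
    ≺-irrefl : ∀ {v} → ¬ v ≺ v
    ≺-irrefl v≺v = ≺-asym v≺v v≺v

  agree-below⇒¬≺ : ∀ {m} (f g : Fin m → A) → (∀ x → ∃[ y ] g y ≡ f x) →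
                   (∀ {x y} → x F.< y → f x ≺ f y) → (∀ {x y} → x F.< y → g x ≺ g y) →
                   ∀ x → (∀ y → y F.< x → f y ≡ g y) → ¬ f x ≺ g x
  agree-below⇒¬≺ f g f⊆g f↑ g↑ x agree fx≺gx with f⊆g x
  ... | y , gy≡fx with FinP.<-cmp y x
  ...   | tri< y<x _ _ = ≺-irrefl (subst (_≺ f x) (trans (agree y y<x) gy≡fx) (f↑ y<x))
  ...   | tri≈ _ refl _ = ≺-irrefl (subst (f x ≺_) gy≡fx fx≺gx)
  ...   | tri> _ _ x<y = ≺-asym fx≺gx (subst (g x ≺_) gy≡fx (g↑ x<y))

  increasing-unique : ∀ {m} (f g : Fin m → A) → DecidableEquality A →
                      (∀ x → ∃[ y ] g y ≡ f x) → (∀ x → ∃[ y ] f y ≡ g x) →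
                      (∀ {x y} → x F.< y → f x ≺ f y) → (∀ {x y} → x F.< y → g x ≺ g y) →
                      (∀ x → f x ≢ g x → f x ≺ g x ⊎ g x ≺ f x) →
                      ∀ x → f x ≡ g x
  increasing-unique f g _≟_ f⊆g g⊆f f↑ g↑ connex x = agree x (<-wellFounded x)
    where
    agree : ∀ x → Acc F._<_ x → f x ≡ g x
    agree x (acc rec) with f x ≟ g x
    ... | yes fx≡gx = fx≡gx
    ... | no fx≢gx with connex x fx≢gx
    ...   | inj₁ fx≺gx =
      ⊥-elim (agree-below⇒¬≺ f g f⊆g f↑ g↑ x (λ y y<x → agree y (rec y<x)) fx≺gx)
    ...   | inj₂ gx≺fx =
      ⊥-elim (agree-below⇒¬≺ g f g⊆f g↑ f↑ x (λ y y<x → sym (agree y (rec y<x))) gx≺fx)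

-- The shape J 0 (J+1) ⋯ (n+1) 1 ⋯ (J−1).
record Rotated {n} (J : ℕ) (π : Vec (Fin (suc (suc n))) (suc (suc n))) : Set where
  field
    head≡J      : π ! zero ≡ J
    second≡0    : π ! suc zero ≡ 0
    tail≢J      : ∀ x → π ! suc (suc x) ≢ J
    tail≢0      : ∀ x → π ! suc (suc x) ≢ 0
    tail-sorted : ∀ {x y} → x F.< y → π ! suc (suc x) <[ J ] π ! suc (suc y)

module _ {n J} {π : Vec (Fin (suc (suc n))) (suc (suc n))} (rotated : Rotated J π) where
  open Rotated rotated

  rotated-tail-injective : ∀ {x y} → π ! suc (suc x) ≡ π ! suc (suc y) → x ≡ y
  rotated-tail-injective {x} {y} e with FinP.<-cmp x y
  ... | tri< x<y _ _ = ⊥-elim (<[]-irrefl (subst (_<[ J ] π ! suc (suc y)) e (tail-sorted x<y)))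
  ... | tri≈ _ x≡y _ = x≡y
  ... | tri> _ _ y<x = ⊥-elim (<[]-irrefl (subst (_<[ J ] π ! suc (suc x)) (sym e) (tail-sorted y<x)))

  rotated⇒isPerm : J ≢ 0 → IsPerm π
  rotated⇒isPerm J≢0 {x} {y} e = positions x y (cong toℕ e)
    where
    positions : ∀ x y → π ! x ≡ π ! y → x ≡ y
    positions zero zero _ = refl
    positions zero (suc zero) e = ⊥-elim (J≢0 (trans (sym head≡J) (trans e second≡0)))
    positions zero (suc (suc y)) e = ⊥-elim (tail≢J y (trans (sym e) head≡J))
    positions (suc zero) zero e = ⊥-elim (J≢0 (trans (sym head≡J) (trans (sym e) second≡0)))
    positions (suc zero) (suc zero) _ = refl
    positions (suc zero) (suc (suc y)) e = ⊥-elim (tail≢0 y (trans (sym e) second≡0))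
    positions (suc (suc x)) zero e = ⊥-elim (tail≢J x (trans e head≡J))
    positions (suc (suc x)) (suc zero) e = ⊥-elim (tail≢0 x (trans e second≡0))
    positions (suc (suc x)) (suc (suc y)) e = cong (λ z → suc (suc z)) (rotated-tail-injective e)

  rotated⇒fishburn : Fishburn π
  rotated⇒fishburn (zero , suc zero , _ , _ , _ , _ , v₀<v₁ , _) = ℕ.n≮0 (subst (π ! zero <_) second≡0 v₀<v₁)
  rotated⇒fishburn (suc zero , _ , _ , _ , _ , _ , _ , v₁≡1+vj) = ℕ.0≢1+n (trans (sym second≡0) v₁≡1+vj)
  rotated⇒fishburn (suc (suc x) , _ , suc (suc y) , _ , s<s (s<s x<y) , vj<vi , _ , vi≡1+vj)
    with J<vi , vj<J ← <[]-descent (tail-sorted x<y) vj<vi =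
    ℕ.<-irrefl refl (ℕ.<-≤-trans J<vi (subst (_≤ J) (sym vi≡1+vj) vj<J))

  rotated-inversion : ∀ {a b} → a F.< b → π ! b < π ! a → π ! b < J × J ≤ π ! a
  rotated-inversion {zero} {b} _ vb<v₀ = subst (π ! b <_) head≡J vb<v₀ , ℕ.≤-reflexive (sym head≡J)
  rotated-inversion {suc zero} {b} _ vb<v₁ = ⊥-elim (ℕ.n≮0 (subst (π ! b <_) second≡0 vb<v₁))
  rotated-inversion {suc (suc x)} {suc (suc y)} (s<s (s<s x<y)) vb<va
    with J<va , vb<J ← <[]-descent (tail-sorted x<y) vb<va = vb<J , ℕ.<⇒≤ J<va

  rotated-rise-across : ∀ {a b} → a F.< b → π ! a < J → J < π ! b → π ! a ≡ 0
  rotated-rise-across {zero} _ v₀<J _ = ⊥-elim (ℕ.<-irrefl head≡J v₀<J)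
  rotated-rise-across {suc zero} _ _ _ = second≡0
  rotated-rise-across {suc (suc x)} {suc (suc y)} (s<s (s<s x<y)) va<J J<vb =
    ⊥-elim (ℕ.<-asym va<J (proj₁ (<[]-above (tail-sorted x<y) J<vb)))

  rotated⇒avoids-321 : ¬ Occurs321 π
  rotated⇒avoids-321 (a , b , c , a<b , b<c , vc<vb , vb<va) =
    ℕ.<⇒≱ (proj₁ (rotated-inversion a<b vb<va)) (proj₂ (rotated-inversion b<c vc<vb))

  rotated⇒avoids-2143 : ¬ Occurs2143 π
  rotated⇒avoids-2143 (a , b , c , d , a<b , b<c , c<d , vb<va , va<vd , vd<vc) =
    ℕ.<-irrefl refl (ℕ.≤-<-trans (proj₂ (rotated-inversion a<b vb<va))
                      (ℕ.<-trans va<vd (proj₁ (rotated-inversion c<d vd<vc))))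

  rotated⇒avoids-3124 : ¬ Occurs3124 π
  rotated⇒avoids-3124 (a , b , c , d , a<b , b<c , c<d , vb<vc , vc<va , va<vd) =
    ℕ.n≮0 (subst (π ! b <_) (rotated-rise-across c<d vc<J (ℕ.≤-<-trans J≤va va<vd)) vb<vc)
    where
    J≤va : J ≤ π ! a
    J≤va = proj₂ (rotated-inversion a<b (ℕ.<-trans vb<vc vc<va))
    vc<J : π ! c < J
    vc<J = proj₁ (rotated-inversion (ℕ.<-trans a<b b<c) vc<va)

  rotated⇒counted : J ≢ 0 → Counted π
  rotated⇒counted J≢0 = rotated⇒isPerm J≢0 , rotated⇒fishburn ,
    rotated⇒avoids-321 ∘ to (occurs-321 {π = π}) , rotated⇒avoids-2143 ∘ to (occurs-2143 {π = π}) ,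
    rotated⇒avoids-3124 ∘ to (occurs-3124 {π = π})
    where open Equivalence

rotated-tail-⊆ : ∀ {n J} {π σ : Vec (Fin (suc (suc n))) (suc (suc n))} → Rotated J π → Rotated J σ →
                 IsPerm σ → ∀ x → ∃[ y ] σ ! suc (suc y) ≡ π ! suc (suc x)
rotated-tail-⊆ {π = π} {σ} π-rotated σ-rotated σ-perm x
  with injective⇒onto (lookup σ) σ-perm (lookup π (suc (suc x)))
... | zero , e =
  ⊥-elim (Rotated.tail≢J π-rotated x (trans (sym (cong toℕ e)) (Rotated.head≡J σ-rotated)))
... | suc zero , e =
  ⊥-elim (Rotated.tail≢0 π-rotated x (trans (sym (cong toℕ e)) (Rotated.second≡0 σ-rotated)))
... | suc (suc y) , e = y , cong toℕ e

rotated-unique : ∀ {n J} {π σ : Vec (Fin (suc (suc n))) (suc (suc n))} → Rotated J π → Rotated J σ →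
                 IsPerm π → IsPerm σ → π ≡ σ
rotated-unique {J = J} {π} {σ} π-rotated σ-rotated π-perm σ-perm =
  Pointwise-≡⇒≡ (ext (FinP.toℕ-injective ∘ agree))
  where
  module π = Rotated π-rotated
  module σ = Rotated σ-rotated
  tails-agree : ∀ x → π ! suc (suc x) ≡ σ ! suc (suc x)
  tails-agree = increasing-unique {_≺_ = _<[ J ]_} <[]-asym
    (λ x → π ! suc (suc x)) (λ x → σ ! suc (suc x)) ℕ._≟_
    (rotated-tail-⊆ π-rotated σ-rotated σ-perm) (rotated-tail-⊆ σ-rotated π-rotated π-perm)
    π.tail-sorted σ.tail-sorted (λ x → <[]-total (π.tail≢J x) (σ.tail≢J x))
  agree : ∀ x → π ! x ≡ σ ! x
  agree zero = trans π.head≡J (sym σ.head≡J)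
  agree (suc zero) = trans π.second≡0 (sym σ.second≡0)
  agree (suc (suc x)) = tails-agree x

module _ {n} (π : Vec (Fin (suc (suc n))) (suc (suc n))) (perm : IsPerm π) {K : Fin (suc n)}
         (head : lookup π zero ≡ suc K) where

  private
    J : ℕ
    J = suc (toℕ K)

    head≡J : π ! zero ≡ J
    head≡J = cong toℕ head

    !-injective : ∀ {x y} → π ! x ≡ π ! y → x ≡ y
    !-injective = perm ∘ FinP.toℕ-injective

  counted-tail≢J : ∀ x → π ! suc (suc x) ≢ J
  counted-tail≢J x e with () ← !-injective (trans head≡J (sym e))

  -- Otherwise the value J − 1, which lies further right, makes positions 0, 1 a Fishburn pattern.
  counted-second<J : Fishburn π → π ! suc zero < J
  counted-second<J fish with ℕ.<-cmp (π ! suc zero) J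
  ... | tri< v₁<J _ _ = v₁<J
  ... | tri≈ _ v₁≡J _ with () ← !-injective (trans v₁≡J (sym head≡J))
  ... | tri> _ _ J<v₁ with injective⇒onto (lookup π) perm (inject₁ K)
  ...   | zero , e = ⊥-elim (ℕ.1+n≢n (trans (cong toℕ (trans (sym head) e)) (FinP.toℕ-inject₁ K)))
  ...   | suc q , e = ⊥-elim $ fish (zero , suc zero , suc q , refl , z<s , vq<v₀ ,
                                   subst (_< π ! suc zero) (sym head≡J) J<v₁ , trans head≡J (cong suc (sym vq≡K)))
    where
    vq≡K : π ! suc q ≡ toℕ K
    vq≡K = trans (cong toℕ e) (FinP.toℕ-inject₁ K)
    vq<v₀ : π ! suc q < π ! zero
    vq<v₀ = subst₂ _<_ (sym vq≡K) (sym head≡J) (ℕ.n<1+n (toℕ K))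

  -- Otherwise 0 lies further right and J, π₁, 0 is a 321.
  counted-second≡0 : ¬ Occurs321 π → π ! suc zero < J → π ! suc zero ≡ 0
  counted-second≡0 no-321 v₁<J with injective⇒onto (lookup π) perm zero
  ... | zero , e with () ← trans (sym head) e
  ... | suc zero , e = cong toℕ e
  ... | suc (suc q) , e = ⊥-elim (no-321 (zero , suc zero , suc (suc q) , z<s , s<s z<s ,
                                          subst (_< π ! suc zero) (sym (cong toℕ e)) (ℕ.n≢0⇒n>0 v₁≢0) ,
                                          subst (π ! suc zero <_) (sym head≡J) v₁<J))
    where
    v₁≢0 : π ! suc zero ≢ 0
    v₁≢0 v₁≡0 with () ← !-injective (trans v₁≡0 (sym (cong toℕ e)))

  module _ (v₁≡0 : π ! suc zero ≡ 0) where

    counted-tail≢0 : ∀ x → π ! suc (suc x) ≢ 0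
    counted-tail≢0 x e with () ← !-injective (trans e (sym v₁≡0))

    counted-tail-sorted : ¬ Occurs321 π → ¬ Occurs2143 π → ¬ Occurs3124 π →
                          ∀ {x y} → x F.< y → π ! suc (suc x) <[ J ] π ! suc (suc y)
    counted-tail-sorted no-321 no-2143 no-3124 {x} {y} x<y
      with ℕ.<-cmp (π ! suc (suc x)) J | ℕ.<-cmp (π ! suc (suc y)) J
         | ℕ.<-cmp (π ! suc (suc x)) (π ! suc (suc y))
    ... | tri≈ _ v≡J _ | _ | _ = ⊥-elim (counted-tail≢J x v≡J)
    ... | _ | tri≈ _ w≡J _ | _ = ⊥-elim (counted-tail≢J y w≡J)
    ... | _ | _ | tri≈ _ v≡w _ =
      ⊥-elim (FinP.<-irrefl (FinP.suc-injective (FinP.suc-injective (!-injective v≡w))) x<y)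
    ... | tri> _ _ J<v | tri< w<J _ _ | _ = across J<v w<J
    ... | tri> _ _ J<v | tri> _ _ _ | tri< v<w _ _ = above J<v v<w
    ... | tri< _ _ _ | tri< w<J _ _ | tri< v<w _ _ = below w<J v<w
    ... | tri< v<J _ _ | tri> _ _ J<w | _ =
      ⊥-elim (no-3124 (zero , suc zero , suc (suc x) , suc (suc y) , z<s , s<s z<s , s<s (s<s x<y) ,
                       subst (_< π ! suc (suc x)) (sym v₁≡0) (ℕ.n≢0⇒n>0 (counted-tail≢0 x)) ,
                       subst (π ! suc (suc x) <_) (sym head≡J) v<J ,
                       subst (_< π ! suc (suc y)) (sym head≡J) J<w))
    ... | tri> _ _ J<v | tri> _ _ J<w | tri> _ _ w<v =
      ⊥-elim (no-2143 (zero , suc zero , suc (suc x) , suc (suc y) , z<s , s<s z<s , s<s (s<s x<y) ,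
                       subst₂ _<_ (sym v₁≡0) (sym head≡J) z<s ,
                       subst (_< π ! suc (suc y)) (sym head≡J) J<w , w<v))
    ... | tri< v<J _ _ | tri< _ _ _ | tri> _ _ w<v =
      ⊥-elim (no-321 (zero , suc (suc x) , suc (suc y) , z<s , s<s (s<s x<y) , w<v ,
                      subst (π ! suc (suc x) <_) (sym head≡J) v<J))

counted⇒rotated : ∀ {n K} {π : Vec (Fin (suc (suc n))) (suc (suc n))} → Counted π → lookup π zero ≡ suc K →
                  Rotated (suc (toℕ K)) π
counted⇒rotated {π = π} (perm , fish , avoids-321 , avoids-2143 , avoids-3124) head = record
  { head≡J = cong toℕ head
  ; second≡0 = v₁≡0
  ; tail≢J = counted-tail≢J π perm head
  ; tail≢0 = counted-tail≢0 π perm head v₁≡0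
  ; tail-sorted = counted-tail-sorted π perm head v₁≡0 no-321 no-2143 no-3124
  }
  where
  open Equivalence
  no-321 : ¬ Occurs321 π
  no-321 = avoids-321 ∘ from (occurs-321 {π = π})
  no-2143 : ¬ Occurs2143 π
  no-2143 = avoids-2143 ∘ from (occurs-2143 {π = π})
  no-3124 : ¬ Occurs3124 π
  no-3124 = avoids-3124 ∘ from (occurs-3124 {π = π})
  v₁≡0 : π ! suc zero ≡ 0
  v₁≡0 = counted-second≡0 π perm head no-321 (counted-second<J π perm head fish)

wrap : ℕ → ℕ → ℕ
wrap N s with s ≤? N
... | yes _ = s
... | no _ = s ∸ N

wrap-cases : ∀ N s → (s ≤ N × wrap N s ≡ s) ⊎ (N < s × wrap N s ≡ s ∸ N)
wrap-cases N s with s ≤? N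
... | yes s≤N = inj₁ (s≤N , refl)
... | no s≰N = inj₂ (ℕ.≰⇒> s≰N , refl)

wrap-< : ∀ N s → s ≤ N + N → wrap N s < suc N
wrap-< N s s≤2N with s ≤? N
... | yes s≤N = s<s s≤N
... | no _ = s<s (ℕ.m≤n+o⇒m∸n≤o s N s≤2N)

module _ {N J : ℕ} where

  private
    overflow<J : ∀ {s} → N < s → s < N + J → s ∸ N < J
    overflow<J {s} N<s s<N+J = subst (s ∸ N <_) (ℕ.m+n∸m≡n N J) (ℕ.∸-monoˡ-< s<N+J (ℕ.<⇒≤ N<s))

  wrap-≢ : ∀ {s} → J < s → s < N + J → wrap N s ≢ J
  wrap-≢ {s} J<s s<N+J w≡J with wrap-cases N s
  ... | inj₁ (_ , w≡s) = ℕ.<-irrefl (trans (sym w≡J) w≡s) J<s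
  ... | inj₂ (N<s , w≡s∸N) = ℕ.<-irrefl (trans (sym w≡s∸N) w≡J) (overflow<J N<s s<N+J)

  wrap-sorted : ∀ {s t} → J < s → s < t → t < N + J → wrap N s <[ J ] wrap N t
  wrap-sorted {s} {t} J<s s<t t<N+J with wrap-cases N s | wrap-cases N t
  ... | inj₁ (_ , ws≡) | inj₁ (_ , wt≡) rewrite ws≡ | wt≡ = above J<s s<t
  ... | inj₁ (_ , ws≡) | inj₂ (N<t , wt≡) rewrite ws≡ | wt≡ = across J<s (overflow<J N<t t<N+J)
  ... | inj₂ (N<s , _) | inj₁ (t≤N , _) = ⊥-elim (ℕ.<-asym N<s (ℕ.<-≤-trans s<t t≤N))
  ... | inj₂ (N<s , ws≡) | inj₂ (N<t , wt≡) rewrite ws≡ | wt≡ =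
    below (overflow<J N<t t<N+J) (ℕ.∸-monoˡ-< s<t (ℕ.<⇒≤ N<s))

wrap-≢0 : ∀ {N s} → 0 < s → wrap N s ≢ 0
wrap-≢0 {N} {s} 0<s w≡0 with wrap-cases N s
... | inj₁ (_ , w≡s) = ℕ.<-irrefl (trans (sym w≡0) w≡s) 0<s
... | inj₂ (N<s , w≡s∸N) = ℕ.<-irrefl (trans (sym w≡0) w≡s∸N) (ℕ.m<n⇒0<n∸m N<s)

-- J 0 (J+1) ⋯ n 1 ⋯ (J−1) for J = K + 1: the entry at position q + 2 is J + q + 1,
-- reduced by n once it exceeds n.
block : ∀ {n} → Fin n → Vec (Fin (suc n)) (suc n)
block {suc n} K =
  suc K ∷ zero ∷ tabulate (λ q → fromℕ< (wrap-< (suc n) (suc (toℕ K) + suc (toℕ q)) (bound q)))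
  where
  bound : ∀ q → suc (toℕ K) + suc (toℕ q) ≤ suc n + suc n
  bound q = ℕ.+-mono-≤ (FinP.toℕ<n K) (ℕ.m≤n⇒m≤1+n (FinP.toℕ<n q))

block-rotated : ∀ {n} (K : Fin (suc n)) → Rotated (suc (toℕ K)) (block K)
block-rotated {n} K = record
  { head≡J = refl
  ; second≡0 = refl
  ; tail≢J = λ q → subst (_≢ J) (sym (tail≡wrap q)) (wrap-≢ {N} (J<s q) (s<N+J q))
  ; tail≢0 = λ q → subst (_≢ 0) (sym (tail≡wrap q)) (wrap-≢0 {N} (ℕ.<-trans z<s (J<s q)))
  ; tail-sorted = λ {x} {y} x<y → subst₂ _<[ J ]_ (sym (tail≡wrap x)) (sym (tail≡wrap y))
                    (wrap-sorted {N} (J<s x) (ℕ.+-monoʳ-< J (s<s x<y)) (s<N+J y))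
  }
  where
  J N : ℕ
  J = suc (toℕ K)
  N = suc n
  s : Fin n → ℕ
  s q = J + suc (toℕ q)
  J<s : ∀ q → J < s q
  J<s q = ℕ.m<m+n J z<s
  s<N+J : ∀ q → s q < N + J
  s<N+J q = subst (s q <_) (ℕ.+-comm J N) (ℕ.+-monoʳ-< J (s<s (FinP.toℕ<n q)))
  tail≡wrap : ∀ q → block K ! suc (suc q) ≡ wrap N (s q)
  tail≡wrap q = trans (cong toℕ (lookup∘tabulate _ q)) (FinP.toℕ-fromℕ< _)

block-counted : ∀ {n} (K : Fin n) → Counted (block K)
block-counted {suc n} K = rotated⇒counted (block-rotated K) ℕ.1+n≢0

starts-with-suc⇒block : ∀ {n K} {π : Vec (Fin (suc n)) (suc n)} → Counted π → lookup π zero ≡ suc K →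
                        π ≡ block K
starts-with-suc⇒block {suc n} {K} counted head =
  rotated-unique (counted⇒rotated counted head) (block-rotated K) (proj₁ counted) (proj₁ (block-counted K))

1⊕-injective : ∀ {n} {σ σ′ : Vec (Fin n) n} → 1⊕ σ ≡ 1⊕ σ′ → σ ≡ σ′
1⊕-injective {σ = σ} {σ′} e = Pointwise-≡⇒≡ (ext λ i →
  FinP.suc-injective (trans (sym (lookup-1⊕ σ i)) (trans (cong (λ τ → lookup τ (suc i)) e) (lookup-1⊕ σ′ i))))

block-injective : ∀ {n} {K K′ : Fin n} → block K ≡ block K′ → K ≡ K′
block-injective {suc n} e = FinP.suc-injective (cong (λ τ → lookup τ zero) e)

1⊕≢block : ∀ {n} (σ : Vec (Fin n) n) K → 1⊕ σ ≢ block K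
1⊕≢block {suc n} σ K e with () ← cong (λ τ → lookup τ zero) e

counted-[] : Counted {0} []
counted-[] = (λ {x} → ⊥-elim (FinP.¬Fin0 x)) , (λ { (() , _) }) ,
             no-occurrence p321 , no-occurrence p2143 , no-occurrence p3124
  where
  no-occurrence : ∀ {k} (p : Vec (Fin (suc k)) (suc k)) → Avoids p []
  no-occurrence _ (ι , _) = FinP.¬Fin0 (ι zero)

countedList : (n : ℕ) → List (Vec (Fin n) n)
countedList zero = [ [] ]
countedList (suc n) = List.map 1⊕_ (countedList n) ++ List.map block (allFin n)

∈-countedList⇒counted : ∀ n {π} → π ∈ countedList n → Counted π
∈-countedList⇒counted zero (here refl) = counted-[]
∈-countedList⇒counted (suc n) π∈ with ∈-++⁻ (List.map 1⊕_ (countedList n)) π∈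
... | inj₁ π∈1⊕ with σ , σ∈ , refl ← ∈-map⁻ 1⊕_ π∈1⊕ =
  Equivalence.to (counted-1⊕ σ) (∈-countedList⇒counted n σ∈)
... | inj₂ π∈block with K , _ , refl ← ∈-map⁻ block π∈block = block-counted K

counted⇒∈-countedList : ∀ n {π} → Counted π → π ∈ countedList n
counted⇒∈-countedList zero {[]} _ = here refl
counted⇒∈-countedList (suc n) {π} counted with lookup π zero in head
... | zero with σ , refl ← starts-with-0⇒1⊕ π (proj₁ counted) (head) =
  ∈-++⁺ˡ (∈-map⁺ 1⊕_ (counted⇒∈-countedList n (Equivalence.from (counted-1⊕ σ) counted)))
... | suc K = subst (_∈ countedList (suc n)) (sym (starts-with-suc⇒block counted head))
  (∈-++⁺ʳ (List.map 1⊕_ (countedList n)) (∈-map⁺ block (∈-allFin K)))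

countedList-unique : ∀ n → Unique (countedList n)
countedList-unique zero = [] ∷ []
countedList-unique (suc n) =
  ++⁺ (map⁺ 1⊕-injective (countedList-unique n)) (map⁺ block-injective (allFin⁺ n)) disjoint
  where
  disjoint : ∀ {π} → ¬ (π ∈ List.map 1⊕_ (countedList n) × π ∈ List.map block (allFin n))
  disjoint (π∈1⊕ , π∈block) with σ , _ , refl ← ∈-map⁻ 1⊕_ π∈1⊕ | K , _ , e ← ∈-map⁻ block π∈block =
    1⊕≢block σ K e

length-countedList : ∀ n → length (countedList n) ≡ n C 2 + 1
length-countedList zero = refl
length-countedList (suc n) = begin
  length (List.map 1⊕_ (countedList n) ++ List.map block (allFin n))
    ≡⟨ length-++ (List.map 1⊕_ (countedList n)) ⟩
  length (List.map 1⊕_ (countedList n)) + length (List.map block (allFin n))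
    ≡⟨ cong₂ _+_ (length-map 1⊕_ (countedList n)) (length-map block (allFin n)) ⟩
  length (countedList n) + length (allFin n)
    ≡⟨ cong₂ _+_ (length-countedList n) (length-tabulate (λ i → i)) ⟩
  n C 2 + 1 + n
    ≡⟨ ℕ.+-comm (n C 2 + 1) n ⟩
  n + (n C 2 + 1)
    ≡⟨ sym (ℕ.+-assoc n (n C 2) 1) ⟩
  n + n C 2 + 1
    ≡⟨ cong (λ m → m + n C 2 + 1) (sym (nC1≡n n)) ⟩
  n C 1 + n C 2 + 1
    ≡⟨ cong (_+ 1) (nCk+nC[k+1]≡[n+1]C[k+1] n 1) ⟩
  suc n C 2 + 1 ∎
  where open ≡-Reasoning

theorem3p5 : (n : ℕ) →
    ∃[ L ] (Unique {A = Vec (Fin n) n} L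
           × (∀ (π : Vec (Fin n) n) → (π ∈ L ⇔ Counted π))
           × length L ≡ (n C 2) + 1)
theorem3p5 n = countedList n , countedList-unique n ,
               (λ π → mk⇔ (∈-countedList⇒counted n) (counted⇒∈-countedList n)) , length-countedList n
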